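{- Let $t$ be a positive integer and let $d=(d_1,\dots,d_n)$ be a degree sequence with $\mathrm{BP}(d)\neq\emptyset$. If $d_1^2\le \sum d/2+t+1$, then every partition $(a,b)\in\mathrm{BP}(d)$ is $t$-tot-bigraphic.
   Context: A degree sequence is a non-increasing sequence of positive integers with even sum; $d_1$ is its maximum entry. $\mathrm{BP}(d)$ is the set of pairs $(a,b)$ of complementary subsequences of $d$ with equal sums. Multigraphs are loopless (parallel edges allowed). For a multigraph $H=(V,E)$, $\mathrm{TotMult}(H)=|E|-|E'|$ with $E'$ the edge set of the underlying simple graph. $(a,b)$ is $t$-tot-bigraphic if there is a loopless multigraph $H$ with underlying bipartite graph with sides $A,B$, where the degree sequence of $A$ is $a$, that of $B$ is $b$, and $\mathrm{TotMult}(H)\le t$. -}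

module Defs where

open import Data.Nat using (ℕ; _+_; _∸_; _≤_; _<_; _≥_)
open import Data.Nat.Divisibility using (_∣_)
open import Data.Fin using (Fin)
open import Data.List using (List; []; _∷_; length; tabulate; lookup)
open import Data.Nat.ListAction using (sum)
open import Data.List.Relation.Unary.All using (All)
open import Data.List.Relation.Unary.Linked using (Linked)
open import Data.List.Relation.Ternary.Interleaving.Propositional using (Interleaving)
open import Data.Product using (Σ; ∃; _×_; _,_)
open import Relation.Binary.PropositionalEquality using (_≡_)

IsDegreeSequence : List ℕ → Set
IsDegreeSequence d = Linked _≥_ d × All (λ x → 0 < x) d × (2 ∣ sum d)

-- (a , b) ∈ BP(d): a and b are complementary subsequences of d
-- (d is an interleaving of a and b) with equal sums.
InBP : List ℕ → List ℕ × List ℕ → Set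
InBP d (a , b) = Interleaving a b d × (sum a ≡ sum b)

-- A loopless bipartite multigraph with sides A = Fin p, B = Fin q, given by
-- the edge multiplicity m i j between i ∈ A and j ∈ B.
BipMultigraph : ℕ → ℕ → Set
BipMultigraph p q = Fin p → Fin q → ℕ

degA : ∀ {p q} → BipMultigraph p q → Fin p → ℕ
degA {q = q} m i = sum (tabulate (λ j → m i j))

degB : ∀ {p q} → BipMultigraph p q → Fin q → ℕ
degB {p = p} m j = sum (tabulate (λ i → m i j))

numEdges : ∀ {p q} → BipMultigraph p q → ℕ
numEdges m = sum (tabulate (λ i → sum (tabulate (λ j → m i j))))

indicator : ℕ → ℕ
indicator 0 = 0
indicator _ = 1

numSimpleEdges : ∀ {p q} → BipMultigraph p q → ℕ
numSimpleEdges m = sum (tabulate (λ i → sum (tabulate (λ j → indicator (m i j)))))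

TotMult : ∀ {p q} → BipMultigraph p q → ℕ
TotMult m = numEdges m ∸ numSimpleEdges m

TotBigraphic : ℕ → List ℕ × List ℕ → Set
TotBigraphic t (a , b) =
  Σ (BipMultigraph (length a) (length b)) λ m →
    ((i : Fin (length a)) → degA m i ≡ lookup a i) ×
    ((j : Fin (length b)) → degB m j ≡ lookup b j) ×
    (TotMult m ≤ t)

-- Let D = d₁ and σ = Σ a = Σ b.  Pad a and b with k = (D² − 1) ∸ σ ≤ t entries 1 each, so
-- that both have total N ≥ D² − 1 and all entries at most D.  Lay the padded a out as
-- consecutive blocks of positions [0, N), likewise the padded b, and join the A-vertex owning
-- position π y to the B-vertex owning position y, where π turns the row-major index of a cell
-- of a grid with D columns into its column-major index.  Blocks of a are at most D long while
-- all columns but the last have at least D cells (this is where N ≥ D² − 1 is used), and the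
-- blocks of b are non-increasing and at most D long; together this makes the graph simple.
-- Deleting the padding vertices leaves equal degree deficits on both sides, at most k in
-- total, which are restored by adding any multigraph with these margins; so the total
-- multiplicity is at most k ≤ t.
{-# OPTIONS --safe #-}
module Submission where

open import Defs
open import Data.Bool.Base using (Bool; true; false; T; not; _∧_)
open import Data.Bool.Properties using (∧-comm; T-∧)
open import Data.Empty using (⊥; ⊥-elim)
open import Data.Fin using (Fin; zero; suc; toℕ)
open import Data.Fin.Properties using (toℕ<n)
open import Data.List using (List; []; _∷_; _++_; length; lookup; replicate; tabulate)
open import Data.List.Properties using (tabulate-cong)
open import Data.List.Relation.Binary.Sublist.Propositional using (_⊆_; []; _∷_; _∷ʳ_)
open import Data.List.Relation.Binary.Sublist.Propositional.Properties using (All-resp-⊆)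
open import Data.List.Relation.Ternary.Interleaving using ([]; swap)
open import Data.List.Relation.Ternary.Interleaving.Propositional using (Interleaving; consˡ; consʳ; toPermutation)
open import Data.List.Relation.Unary.All as All using (All; _∷_)
import Data.List.Relation.Unary.All.Properties as All
open import Data.List.Relation.Unary.AllPairs using (AllPairs; []; _∷_)
import Data.List.Relation.Unary.AllPairs.Properties as AllPairs
open import Data.List.Relation.Unary.Linked.Properties using (Linked⇒AllPairs)
open import Data.Nat
open import Data.Nat.DivMod
open import Data.Nat.ListAction using (sum)
open import Data.Nat.ListAction.Properties using (sum-++; sum-↭)
open import Data.Nat.Properties
open import Data.Nat.Tactic.RingSolver using (solve-∀)
open import Data.Product using (∃; _×_; _,_)
open import Data.Sum using (inj₁; inj₂)
open import Function using (_∘_)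
open import Function.Bundles using (Equivalence)
open import Relation.Binary.Definitions using (tri<; tri≈; tri>)
open import Relation.Binary.PropositionalEquality
open import Relation.Nullary using (¬_; Dec; yes; no)

-- Sums over initial segments of ℕ

∑< : ℕ → (ℕ → ℕ) → ℕ
∑< zero    f = 0
∑< (suc n) f = ∑< n f + f n

-- The body of ∑[ x < n ] extends over _*_ but not over _+_.
infix 6.5 ∑<
syntax ∑< n (λ x → e) = ∑[ x < n ] e

∑-cong : ∀ n {f g : ℕ → ℕ} → (∀ {x} → x < n → f x ≡ g x) → ∑< n f ≡ ∑< n g
∑-cong zero    f≡g = refl
∑-cong (suc n) f≡g = cong₂ _+_ (∑-cong n (f≡g ∘ m<n⇒m<1+n)) (f≡g (n<1+n n))

∑-mono-≤ : ∀ n {f g : ℕ → ℕ} → (∀ {x} → x < n → f x ≤ g x) → ∑< n f ≤ ∑< n g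
∑-mono-≤ zero    f≤g = z≤n
∑-mono-≤ (suc n) f≤g = +-mono-≤ (∑-mono-≤ n (f≤g ∘ m<n⇒m<1+n)) (f≤g (n<1+n n))

∑-zero : ∀ n → ∑[ _ < n ] 0 ≡ 0
∑-zero zero    = refl
∑-zero (suc n) = cong (_+ 0) (∑-zero n)

∑-const : ∀ n c → ∑[ _ < n ] c ≡ n * c
∑-const zero    c = refl
∑-const (suc n) c = trans (cong (_+ c) (∑-const n c)) (+-comm (n * c) c)

∑-distrib-+ : ∀ n (f g : ℕ → ℕ) → ∑[ x < n ] (f x + g x) ≡ ∑< n f + ∑< n g
∑-distrib-+ zero    f g = refl
∑-distrib-+ (suc n) f g =
  trans (cong (_+ (f n + g n)) (∑-distrib-+ n f g)) (interchange (∑< n f) (∑< n g) (f n) (g n))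
  where
  interchange : ∀ a b c d → a + b + (c + d) ≡ a + c + (b + d)
  interchange = solve-∀

∑-split : ∀ m n (f : ℕ → ℕ) → ∑< (m + n) f ≡ ∑< m f + ∑[ z < n ] f (m + z)
∑-split m zero    f = trans (cong (λ k → ∑< k f) (+-identityʳ m)) (sym (+-identityʳ _))
∑-split m (suc n) f = begin
  ∑< (m + suc n) f                                 ≡⟨ cong (λ k → ∑< k f) (+-suc m n) ⟩
  ∑< (m + n) f + f (m + n)                         ≡⟨ cong (_+ f (m + n)) (∑-split m n f) ⟩
  ∑< m f + ∑[ z < n ] f (m + z) + f (m + n)        ≡⟨ +-assoc (∑< m f) _ _ ⟩
  ∑< m f + ∑[ z < suc n ] f (m + z)                ∎
  where open ≡-Reasoning

∑-monoˡ-≤ : ∀ (f : ℕ → ℕ) {m n} → m ≤ n → ∑< m f ≤ ∑< n f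
∑-monoˡ-≤ f {m} {n} m≤n = begin
  ∑< m f                              ≤⟨ m≤m+n _ _ ⟩
  ∑< m f + ∑[ z < n ∸ m ] f (m + z)   ≡⟨ ∑-split m (n ∸ m) f ⟨
  ∑< (m + (n ∸ m)) f                  ≡⟨ cong (λ k → ∑< k f) (m+[n∸m]≡n m≤n) ⟩
  ∑< n f                              ∎
  where open ≤-Reasoning

∑-swap : ∀ m n (F : ℕ → ℕ → ℕ) → ∑[ x < m ] ∑< n (F x) ≡ ∑[ y < n ] ∑[ x < m ] F x y
∑-swap zero    n F = sym (∑-zero n)
∑-swap (suc m) n F =
  trans (cong (_+ ∑< n (F m)) (∑-swap m n F)) (sym (∑-distrib-+ n (λ y → ∑[ x < m ] F x y) (F m)))

∑-rect : ∀ m n (f : ℕ → ℕ) → ∑< (m * n) f ≡ ∑[ x < m ] ∑[ y < n ] f (x * n + y)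
∑-rect zero    n f = refl
∑-rect (suc m) n f = begin
  ∑< (n + m * n) f                           ≡⟨ cong (λ k → ∑< k f) (+-comm n (m * n)) ⟩
  ∑< (m * n + n) f                           ≡⟨ ∑-split (m * n) n f ⟩
  ∑< (m * n) f + ∑[ y < n ] f (m * n + y)    ≡⟨ cong (_+ ∑[ y < n ] f (m * n + y)) (∑-rect m n f) ⟩
  ∑[ x < suc m ] ∑[ y < n ] f (x * n + y)    ∎
  where open ≡-Reasoning

∑≡0⇒≡0 : ∀ n (f : ℕ → ℕ) → ∑< n f ≡ 0 → ∀ {x} → x < n → f x ≡ 0
∑≡0⇒≡0 (suc n) f ∑≡0 {x} x<1+n with m≤n⇒m<n∨m≡n (≤-pred x<1+n)
... | inj₁ x<n  = ∑≡0⇒≡0 n f (m+n≡0⇒m≡0 _ ∑≡0) x<n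
... | inj₂ refl = m+n≡0⇒n≡0 (∑< n f) ∑≡0

𝟙 : Bool → ℕ
𝟙 true  = 1
𝟙 false = 0

count : ℕ → (ℕ → Bool) → ℕ
count n P = ∑[ x < n ] 𝟙 (P x)

𝟙-T : ∀ {b} → T b → 𝟙 b ≡ 1
𝟙-T {true} _ = refl

𝟙-¬T : ∀ {b} → ¬ T b → 𝟙 b ≡ 0
𝟙-¬T {true}  ¬t = ⊥-elim (¬t _)
𝟙-¬T {false} _  = refl

𝟙-∧-≤ʳ : ∀ a b → 𝟙 (a ∧ b) ≤ 𝟙 b
𝟙-∧-≤ʳ true  b = ≤-refl
𝟙-∧-≤ʳ false b = z≤n

𝟙-∧-not : ∀ a b → 𝟙 (a ∧ b) + 𝟙 (a ∧ not b) ≡ 𝟙 a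
𝟙-∧-not true  true  = refl
𝟙-∧-not true  false = refl
𝟙-∧-not false b     = refl

𝟙-not-∧ : ∀ a b → 𝟙 (a ∧ b) + 𝟙 (not a ∧ b) ≡ 𝟙 b
𝟙-not-∧ true  b     = +-identityʳ (𝟙 b)
𝟙-not-∧ false b     = refl

𝟙-<ᵇ-suc : ∀ v q → 𝟙 (v <ᵇ q) + 𝟙 (v ≡ᵇ q) ≡ 𝟙 (v <ᵇ suc q)
𝟙-<ᵇ-suc zero    zero    = refl
𝟙-<ᵇ-suc zero    (suc q) = refl
𝟙-<ᵇ-suc (suc v) zero    = refl
𝟙-<ᵇ-suc (suc v) (suc q) = 𝟙-<ᵇ-suc v q

∑-𝟙-≡ᵇ : ∀ q v → ∑[ j < q ] 𝟙 (v ≡ᵇ j) ≡ 𝟙 (v <ᵇ q)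
∑-𝟙-≡ᵇ zero    v = refl
∑-𝟙-≡ᵇ (suc q) v = trans (cong (_+ 𝟙 (v ≡ᵇ q)) (∑-𝟙-≡ᵇ q v)) (𝟙-<ᵇ-suc v q)

∑-𝟙-∧-≡ᵇ : ∀ q b v → ∑[ j < q ] 𝟙 (b ∧ (v ≡ᵇ j)) ≡ 𝟙 (b ∧ (v <ᵇ q))
∑-𝟙-∧-≡ᵇ q true  v = ∑-𝟙-≡ᵇ q v
∑-𝟙-∧-≡ᵇ q false v = ∑-zero q

∑-truncate : ∀ {r n} (f : ℕ → ℕ) → r ≤ n → ∑[ x < n ] 𝟙 (x <ᵇ r) * f x ≡ ∑< r f
∑-truncate {r} {n} f r≤n = begin
  ∑[ x < n ] 𝟙 (x <ᵇ r) * f x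
    ≡⟨ cong (λ k → ∑[ x < k ] 𝟙 (x <ᵇ r) * f x) (m+[n∸m]≡n r≤n) ⟨
  ∑[ x < r + (n ∸ r) ] 𝟙 (x <ᵇ r) * f x
    ≡⟨ ∑-split r (n ∸ r) _ ⟩
  ∑[ x < r ] 𝟙 (x <ᵇ r) * f x + ∑[ z < n ∸ r ] 𝟙 (r + z <ᵇ r) * f (r + z)
    ≡⟨ cong₂ _+_ (∑-cong r below) (∑-cong (n ∸ r) above) ⟩
  ∑< r f + ∑[ _ < n ∸ r ] 0
    ≡⟨ trans (cong (∑< r f +_) (∑-zero (n ∸ r))) (+-identityʳ _) ⟩
  ∑< r f ∎
  where
  open ≡-Reasoning
  below : ∀ {x} → x < r → 𝟙 (x <ᵇ r) * f x ≡ f x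
  below {x} x<r = trans (cong (_* f x) (𝟙-T (<⇒<ᵇ x<r))) (*-identityˡ _)
  above : ∀ {z} → z < n ∸ r → 𝟙 (r + z <ᵇ r) * f (r + z) ≡ 0
  above {z} _ = cong (_* f (r + z)) (𝟙-¬T (λ t → m+n≮m r z (<ᵇ⇒< (r + z) r t)))

∑-+𝟙 : ∀ n b (f : ℕ → ℕ) → ∑< (n + 𝟙 b) f ≡ ∑< n f + 𝟙 b * f n
∑-+𝟙 n true  f = trans (cong (λ k → ∑< k f) (+-comm n 1)) (cong (∑< n f +_) (sym (+-identityʳ (f n))))
∑-+𝟙 n false f = trans (cong (λ k → ∑< k f) (+-identityʳ n)) (sym (+-identityʳ _))

count-<ᵇ : ∀ {r n} → r ≤ n → count n (_<ᵇ r) ≡ r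
count-<ᵇ {r} {n} r≤n = begin
  ∑[ x < n ] 𝟙 (x <ᵇ r)       ≡⟨ ∑-cong n (λ _ → *-identityʳ _) ⟨
  ∑[ x < n ] 𝟙 (x <ᵇ r) * 1   ≡⟨ ∑-truncate (λ _ → 1) r≤n ⟩
  ∑[ _ < r ] 1                ≡⟨ ∑-const r 1 ⟩
  r * 1                       ≡⟨ *-identityʳ r ⟩
  r                           ∎
  where open ≡-Reasoning

count-zero : ∀ n {P : ℕ → Bool} → (∀ {x} → x < n → ¬ T (P x)) → count n P ≡ 0
count-zero n never = trans (∑-cong n (𝟙-¬T ∘ never)) (∑-zero n)

count-≤1 : ∀ n (P : ℕ → Bool) → (∀ {x x'} → x < n → x' < n → T (P x) → T (P x') → x ≡ x') →
           count n P ≤ 1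
count-≤1 zero    P unique = z≤n
count-≤1 (suc n) P unique with P n in Pn
... | false = ≤-trans (≤-reflexive (+-identityʳ _))
                      (count-≤1 n P λ x<n x'<n → unique (m<n⇒m<1+n x<n) (m<n⇒m<1+n x'<n))
... | true  = ≤-reflexive (cong (_+ 1) (count-zero n none))
  where
  none : ∀ {x} → x < n → ¬ T (P x)
  none {x} x<n t = <-irrefl (unique (m<n⇒m<1+n x<n) (n<1+n n) t (subst T (sym Pn) _)) x<n

count-∧-≤ʳ : ∀ n (P Q : ℕ → Bool) → count n (λ x → P x ∧ Q x) ≤ count n Q
count-∧-≤ʳ n P Q = ∑-mono-≤ n (λ {x} _ → 𝟙-∧-≤ʳ (P x) (Q x))

count-∧-not : ∀ n (P Q : ℕ → Bool) →
              count n (λ x → P x ∧ Q x) + count n (λ x → P x ∧ not (Q x)) ≡ count n P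
count-∧-not n P Q = trans (sym (∑-distrib-+ n _ _)) (∑-cong n (λ {x} _ → 𝟙-∧-not (P x) (Q x)))

count-not-∧ : ∀ n (P Q : ℕ → Bool) →
              count n (λ x → P x ∧ Q x) + count n (λ x → not (P x) ∧ Q x) ≡ count n Q
count-not-∧ n P Q = trans (sym (∑-distrib-+ n _ _)) (∑-cong n (λ {x} _ → 𝟙-not-∧ (P x) (Q x)))

count-not : ∀ n (P : ℕ → Bool) → count n P + count n (not ∘ P) ≡ n
count-not n P = trans (count-∧-not n (λ _ → true) P) (trans (∑-const n 1) (*-identityʳ n))

∑-count-∧-≡ᵇ : ∀ q n (P : ℕ → Bool) (B : ℕ → ℕ) →
               ∑[ j < q ] count n (λ y → P y ∧ (B y ≡ᵇ j)) ≡ count n (λ y → P y ∧ (B y <ᵇ q))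
∑-count-∧-≡ᵇ q n P B =
  trans (∑-swap q n _) (∑-cong n (λ {y} _ → ∑-𝟙-∧-≡ᵇ q (P y) (B y)))

∑-count-≡ᵇ-∧ : ∀ p n (A : ℕ → ℕ) (P : ℕ → Bool) →
               ∑[ i < p ] count n (λ y → (A y ≡ᵇ i) ∧ P y) ≡ count n (λ y → (A y <ᵇ p) ∧ P y)
∑-count-≡ᵇ-∧ p n A P = begin
  ∑[ i < p ] count n (λ y → (A y ≡ᵇ i) ∧ P y)
    ≡⟨ ∑-cong p (λ _ → ∑-cong n (λ {y} _ → cong 𝟙 (∧-comm (A y ≡ᵇ _) (P y)))) ⟩
  ∑[ i < p ] count n (λ y → P y ∧ (A y ≡ᵇ i))
    ≡⟨ ∑-count-∧-≡ᵇ p n P A ⟩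
  count n (λ y → P y ∧ (A y <ᵇ p))
    ≡⟨ ∑-cong n (λ {y} _ → cong 𝟙 (∧-comm (P y) (A y <ᵇ p))) ⟩
  count n (λ y → (A y <ᵇ p) ∧ P y) ∎
  where open ≡-Reasoning

-- Blocks

data Position (u : ℕ) : ℕ → Set where
  inside : ∀ {x} → x < u → Position u x
  beyond : ∀ z → Position u (u + z)

position : ∀ u x → Position u x
position zero    x       = beyond x
position (suc u) zero    = inside z<s
position (suc u) (suc x) with position u x
... | inside x<u = inside (s<s x<u)
... | beyond z   = beyond z

-- With the entries of l laid out as consecutive intervals of [0, sum l), block l x is the
-- index of the interval containing x.
block : List ℕ → ℕ → ℕ
block []       x = 0
block (u ∷ us) x with x <? u
... | yes _ = 0
... | no  _ = suc (block us (x ∸ u))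

module _ {u : ℕ} (us : List ℕ) where

  block-inside : ∀ {x} → x < u → block (u ∷ us) x ≡ 0
  block-inside {x} x<u with x <? u
  ... | yes _   = refl
  ... | no  x≮u = ⊥-elim (x≮u x<u)

  block-beyond : ∀ z → block (u ∷ us) (u + z) ≡ suc (block us z)
  block-beyond z with u + z <? u
  ... | yes u+z<u = ⊥-elim (m+n≮m u z u+z<u)
  ... | no  _     = cong (suc ∘ block us) (m+n∸m≡n u z)

  block≡0⇒< : ∀ {x} → block (u ∷ us) x ≡ 0 → x < u
  block≡0⇒< {x} eq with position u x
  ... | inside x<u = x<u
  ... | beyond z   = ⊥-elim (1+n≢0 (trans (sym (block-beyond z)) eq))

block-< : ∀ l {x} → x < sum l → block l x < length l
block-< (u ∷ us) {x} x<Σ with position u x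
... | inside x<u = subst (_< length (u ∷ us)) (sym (block-inside us x<u)) z<s
... | beyond z   = subst (_< length (u ∷ us)) (sym (block-beyond us z))
                     (s<s (block-< us (+-cancelˡ-< u z (sum us) x<Σ)))

∑-block-∷ : ∀ u us (F : ℕ → ℕ) →
            ∑[ x < sum (u ∷ us) ] F (block (u ∷ us) x) ≡ ∑[ _ < u ] F 0 + ∑[ z < sum us ] F (suc (block us z))
∑-block-∷ u us F = trans (∑-split u (sum us) _)
  (cong₂ _+_ (∑-cong u (cong F ∘ block-inside us)) (∑-cong (sum us) (λ {z} _ → cong F (block-beyond us z))))

count-block : ∀ l (i : Fin (length l)) → count (sum l) (λ x → block l x ≡ᵇ toℕ i) ≡ lookup l i
count-block (u ∷ us) zero    = begin
  count (sum (u ∷ us)) (λ x → block (u ∷ us) x ≡ᵇ 0)  ≡⟨ ∑-block-∷ u us (λ v → 𝟙 (v ≡ᵇ 0)) ⟩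
  ∑[ _ < u ] 1 + ∑[ _ < sum us ] 0                     ≡⟨ cong₂ _+_ (∑-const u 1) (∑-zero (sum us)) ⟩
  u * 1 + 0                                            ≡⟨ trans (+-identityʳ _) (*-identityʳ u) ⟩
  u                                                    ∎
  where open ≡-Reasoning
count-block (u ∷ us) (suc i) = begin
  count (sum (u ∷ us)) (λ x → block (u ∷ us) x ≡ᵇ toℕ (suc i))
    ≡⟨ ∑-block-∷ u us (λ v → 𝟙 (v ≡ᵇ suc (toℕ i))) ⟩
  ∑[ _ < u ] 0 + count (sum us) (λ z → block us z ≡ᵇ toℕ i)
    ≡⟨ cong (_+ _) (∑-zero u) ⟩
  count (sum us) (λ z → block us z ≡ᵇ toℕ i)
    ≡⟨ count-block us i ⟩
  lookup us i ∎
  where open ≡-Reasoning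

block-++-inside : ∀ l₁ l₂ {x} → x < sum l₁ → block (l₁ ++ l₂) x ≡ block l₁ x
block-++-inside (u ∷ us) l₂ {x} x<Σ with position u x
... | inside x<u = trans (block-inside (us ++ l₂) x<u) (sym (block-inside us x<u))
... | beyond z   = begin
  block (u ∷ us ++ l₂) (u + z)   ≡⟨ block-beyond (us ++ l₂) z ⟩
  suc (block (us ++ l₂) z)       ≡⟨ cong suc (block-++-inside us l₂ (+-cancelˡ-< u z (sum us) x<Σ)) ⟩
  suc (block us z)               ≡⟨ block-beyond us z ⟨
  block (u ∷ us) (u + z)         ∎
  where open ≡-Reasoning

block-++-beyond : ∀ l₁ l₂ z → block (l₁ ++ l₂) (sum l₁ + z) ≡ length l₁ + block l₂ z
block-++-beyond []       l₂ z = refl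
block-++-beyond (u ∷ us) l₂ z = begin
  block (u ∷ us ++ l₂) (u + sum us + z)   ≡⟨ cong (block (u ∷ us ++ l₂)) (+-assoc u (sum us) z) ⟩
  block (u ∷ us ++ l₂) (u + (sum us + z)) ≡⟨ block-beyond (us ++ l₂) (sum us + z) ⟩
  suc (block (us ++ l₂) (sum us + z))     ≡⟨ cong suc (block-++-beyond us l₂ z) ⟩
  suc (length us + block l₂ z)            ∎
  where open ≡-Reasoning

∑-block-++ : ∀ l₁ l₂ (F : ℕ → ℕ) →
             ∑[ x < sum l₁ + sum l₂ ] F (block (l₁ ++ l₂) x)
               ≡ ∑[ x < sum l₁ ] F (block l₁ x) + ∑[ z < sum l₂ ] F (length l₁ + block l₂ z)
∑-block-++ l₁ l₂ F = trans (∑-split (sum l₁) (sum l₂) _)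
  (cong₂ _+_ (∑-cong (sum l₁) (cong F ∘ block-++-inside l₁ l₂))
             (∑-cong (sum l₂) (λ {z} _ → cong F (block-++-beyond l₁ l₂ z))))

count-block-++-≡ᵇ : ∀ l₁ l₂ (i : Fin (length l₁)) →
                    count (sum l₁ + sum l₂) (λ x → block (l₁ ++ l₂) x ≡ᵇ toℕ i) ≡ lookup l₁ i
count-block-++-≡ᵇ l₁ l₂ i = begin
  count (sum l₁ + sum l₂) (λ x → block (l₁ ++ l₂) x ≡ᵇ toℕ i)
    ≡⟨ ∑-block-++ l₁ l₂ (λ v → 𝟙 (v ≡ᵇ toℕ i)) ⟩
  count (sum l₁) (λ x → block l₁ x ≡ᵇ toℕ i)
    + count (sum l₂) (λ z → length l₁ + block l₂ z ≡ᵇ toℕ i)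
    ≡⟨ cong₂ _+_ (count-block l₁ i) (count-zero (sum l₂) (λ _ t → i≢ (≡ᵇ⇒≡ _ _ t))) ⟩
  lookup l₁ i + 0
    ≡⟨ +-identityʳ _ ⟩
  lookup l₁ i ∎
  where
  open ≡-Reasoning
  i≢ : ∀ {z} → length l₁ + z ≢ toℕ i
  i≢ {z} eq = <⇒≱ (toℕ<n i) (subst (length l₁ ≤_) eq (m≤m+n _ z))

count-block-++-<ᵇ : ∀ l₁ l₂ →
                    count (sum l₁ + sum l₂) (λ x → block (l₁ ++ l₂) x <ᵇ length l₁) ≡ sum l₁
count-block-++-<ᵇ l₁ l₂ = begin
  count (sum l₁ + sum l₂) (λ x → block (l₁ ++ l₂) x <ᵇ length l₁)
    ≡⟨ ∑-block-++ l₁ l₂ (λ v → 𝟙 (v <ᵇ length l₁)) ⟩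
  count (sum l₁) (λ x → block l₁ x <ᵇ length l₁)
    + count (sum l₂) (λ z → length l₁ + block l₂ z <ᵇ length l₁)
    ≡⟨ cong₂ _+_ (∑-cong (sum l₁) (𝟙-T ∘ <⇒<ᵇ ∘ block-< l₁))
                 (count-zero (sum l₂) (λ {z} _ t → m+n≮m (length l₁) (block l₂ z) (<ᵇ⇒< _ _ t))) ⟩
  ∑[ _ < sum l₁ ] 1 + 0
    ≡⟨ trans (+-identityʳ _) (trans (∑-const (sum l₁) 1) (*-identityʳ _)) ⟩
  sum l₁ ∎
  where open ≡-Reasoning

ShortFibres : ℕ → ℕ → (ℕ → ℕ) → Set
ShortFibres D N f = ∀ {x x'} → x ≤ x' → x' < N → f x ≡ f x' → x' < x + D

short-far : ∀ {D N f x x'} → ShortFibres D N f → x + D ≤ x' → x' < N → f x ≢ f x'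
short-far {D} {x = x} short gap x'<N eq = <⇒≱ (short (≤-trans (m≤m+n x D) gap) x'<N eq) gap

FullFibresAligned : ℕ → ℕ → (ℕ → ℕ) → Set
FullFibresAligned E N f = ∀ {y} → y + E < N → f y ≡ f (y + E) → y % suc E ≡ 0

JointlyInjective : ℕ → (ℕ → ℕ) → (ℕ → ℕ) → Set
JointlyInjective N f g = ∀ {y y'} → y < N → y' < N → f y ≡ f y' → g y ≡ g y' → y ≡ y'

block-short : ∀ {D} l → All (_≤ D) l → ShortFibres D (sum l) (block l)
block-short {D} (u ∷ us) (u≤D ∷ us≤D) {x} {x'} x≤x' x'<Σ eq with position u x' | position u x
... | inside x'<u | _          = ≤-trans x'<u (≤-trans u≤D (m≤n+m D x))
... | beyond z'   | inside x<u = ⊥-elim (0≢1+n (trans (sym (block-inside us x<u)) (trans eq (block-beyond us z'))))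
... | beyond z'   | beyond z   = subst (u + z' <_) (sym (+-assoc u z D)) (+-monoʳ-< u
  (block-short us us≤D (+-cancelˡ-≤ u z z' x≤x') (+-cancelˡ-< u z' (sum us) x'<Σ)
     (suc-injective (trans (sym (block-beyond us z)) (trans eq (block-beyond us z'))))))

block-aligned : ∀ {E} l → AllPairs _≥_ l → All (_≤ suc E) l → FullFibresAligned E (sum l) (block l)
block-aligned {E} (u ∷ us) (u≥us ∷ sorted) (u≤D ∷ us≤D) {y} y+E<Σ eq with position u y
... | inside y<u = subst (λ v → v % suc E ≡ 0) (sym y≡0) refl
  where
  y+E<u : y + E < u
  y+E<u = block≡0⇒< us (trans (sym eq) (block-inside us y<u))
  y≡0 : y ≡ 0
  y≡0 = n≤0⇒n≡0 (+-cancelʳ-≤ E y 0 (≤-pred (≤-trans y+E<u u≤D)))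
... | beyond z = aligned (u <? suc E)
  where
  z+E<Σ : z + E < sum us
  z+E<Σ = +-cancelˡ-< u (z + E) (sum us) (subst (_< u + sum us) (+-assoc u z E) y+E<Σ)
  shifted : block us z ≡ block us (z + E)
  shifted = suc-injective (begin
    suc (block us z)               ≡⟨ block-beyond us z ⟨
    block (u ∷ us) (u + z)         ≡⟨ eq ⟩
    block (u ∷ us) (u + z + E)     ≡⟨ cong (block (u ∷ us)) (+-assoc u z E) ⟩
    block (u ∷ us) (u + (z + E))   ≡⟨ block-beyond us (z + E) ⟩
    suc (block us (z + E))         ∎)
    where open ≡-Reasoning
  aligned : Dec (u < suc E) → (u + z) % suc E ≡ 0
  aligned (yes u<D) = ⊥-elim (n≮n (z + E) (block-short us us≤E (m≤m+n z E) z+E<Σ shifted))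
    where
    us≤E : All (_≤ E) us
    us≤E = All.map (λ v≤u → ≤-pred (≤-trans (s≤s v≤u) u<D)) u≥us
  aligned (no u≮D) = begin
    (u + z) % suc E       ≡⟨ cong (λ v → (v + z) % suc E) (≤-antisym u≤D (≮⇒≥ u≮D)) ⟩
    (suc E + z) % suc E   ≡⟨ cong (_% suc E) (+-comm (suc E) z) ⟩
    (z + suc E) % suc E   ≡⟨ [m+n]%n≡m%n z (suc E) ⟩
    z % suc E             ≡⟨ block-aligned us sorted us≤D z+E<Σ shifted ⟩
    0                     ∎
    where open ≡-Reasoning

-- The grid

row-order : ∀ {D c c' g g'} → g < D → c < c' → c * D + g ≤ c' * D + g'
row-order {D} {c} {c'} {g} {g'} g<D c<c' = begin
  c * D + g    ≤⟨ +-monoʳ-≤ (c * D) (<⇒≤ g<D) ⟩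
  c * D + D    ≡⟨ +-comm (c * D) D ⟩
  suc c * D    ≤⟨ *-monoˡ-≤ D c<c' ⟩
  c' * D       ≤⟨ m≤m+n (c' * D) g' ⟩
  c' * D + g'  ∎
  where open ≤-Reasoning

adjacent-row : ∀ {D c c' g g'} → g < D → c < c' → c' * D + g' < c * D + g + D → c' ≡ suc c × g' < g
adjacent-row {D} {c} {c'} {g} {g'} g<D c<c' close = c'≡1+c , g'<g
  where
  two-rows : ∀ c d → c * d + d + d ≡ suc (suc c) * d
  two-rows = solve-∀
  c'≡1+c : c' ≡ suc c
  c'≡1+c = ≤-antisym (≮⇒≥ λ 1+c<c' → <-asym close (begin-strict
    c * D + g + D       <⟨ +-monoˡ-< D (+-monoʳ-< (c * D) g<D) ⟩
    c * D + D + D       ≡⟨ two-rows c D ⟩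
    suc (suc c) * D     ≤⟨ *-monoˡ-≤ D 1+c<c' ⟩
    c' * D              ≤⟨ m≤m+n (c' * D) g' ⟩
    c' * D + g'         ∎)) c<c'
    where open ≤-Reasoning
  g'<g : g' < g
  g'<g = +-cancelˡ-< (c * D + D) g' g (subst₂ _<_ (next c D g') (rotate c D g) next-row-close)
    where
    next-row-close : suc c * D + g' < c * D + g + D
    next-row-close = subst (λ k → k * D + g' < c * D + g + D) c'≡1+c close
    next : ∀ c d g' → suc c * d + g' ≡ c * d + d + g'
    next = solve-∀
    rotate : ∀ c d g → c * d + g + d ≡ c * d + d + g
    rotate = solve-∀

-- [0, N) as a grid with D = suc E columns, column g having len g cells (C or C + 1).  A cell
-- has row-major index c * D + g and column-major index offset g + c, and π maps the former to
-- the latter.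
module Grid (E N : ℕ) where

  D : ℕ
  D = suc E

  C : ℕ
  C = N / D

  r : ℕ
  r = N % D

  len : ℕ → ℕ
  len g = C + 𝟙 (g <ᵇ r)

  offset : ℕ → ℕ
  offset g = ∑< g len

  π : ℕ → ℕ
  π y = offset (y % D) + y / D

  C*D+r≡N : C * D + r ≡ N
  C*D+r≡N = trans (+-comm (C * D) r) (sym (m≡m%n+[m/n]*n N D))

  offset-D : offset D ≡ N
  offset-D = begin
    ∑[ g < D ] (C + 𝟙 (g <ᵇ r))      ≡⟨ ∑-distrib-+ D _ _ ⟩
    ∑[ _ < D ] C + count D (_<ᵇ r)   ≡⟨ cong₂ _+_ (∑-const D C) (count-<ᵇ (<⇒≤ (m%n<n N D))) ⟩
    D * C + r                        ≡⟨ cong (_+ r) (*-comm D C) ⟩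
    C * D + r                        ≡⟨ C*D+r≡N ⟩
    N                                ∎
    where open ≡-Reasoning

  ∑-columns : ∀ G (H : ℕ → ℕ) → ∑< (offset G) H ≡ ∑[ g < G ] ∑[ c < len g ] H (offset g + c)
  ∑-columns zero    H = refl
  ∑-columns (suc G) H =
    trans (∑-split (offset G) (len G) H) (cong (_+ ∑[ c < len G ] H (offset G + c)) (∑-columns G H))

  ∑-rows : ∀ (F : ℕ → ℕ) → ∑< N F ≡ ∑[ g < D ] ∑[ c < len g ] F (c * D + g)
  ∑-rows F = begin
    ∑< N F
      ≡⟨ cong (λ k → ∑< k F) C*D+r≡N ⟨
    ∑< (C * D + r) F
      ≡⟨ ∑-split (C * D) r F ⟩
    ∑< (C * D) F + ∑[ g < r ] F (C * D + g)
      ≡⟨ cong₂ _+_ (sym (∑-rect C D F)) (∑-truncate (λ g → F (C * D + g)) (<⇒≤ (m%n<n N D))) ⟨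
    ∑[ c < C ] ∑[ g < D ] F (c * D + g) + ∑[ g < D ] 𝟙 (g <ᵇ r) * F (C * D + g)
      ≡⟨ cong (_+ ∑[ g < D ] 𝟙 (g <ᵇ r) * F (C * D + g)) (∑-swap C D (λ c g → F (c * D + g))) ⟩
    ∑[ g < D ] ∑[ c < C ] F (c * D + g) + ∑[ g < D ] 𝟙 (g <ᵇ r) * F (C * D + g)
      ≡⟨ ∑-distrib-+ D _ _ ⟨
    ∑[ g < D ] (∑[ c < C ] F (c * D + g) + 𝟙 (g <ᵇ r) * F (C * D + g))
      ≡⟨ ∑-cong D (λ {g} _ → ∑-+𝟙 C (g <ᵇ r) (λ c → F (c * D + g))) ⟨
    ∑[ g < D ] ∑[ c < len g ] F (c * D + g) ∎
    where open ≡-Reasoning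

  %-row : ∀ c {g} → g < D → (c * D + g) % D ≡ g
  %-row c {g} g<D = begin
    (c * D + g) % D   ≡⟨ cong (_% D) (+-comm (c * D) g) ⟩
    (g + c * D) % D   ≡⟨ [m+kn]%n≡m%n g c D ⟩
    g % D             ≡⟨ m<n⇒m%n≡m g<D ⟩
    g                 ∎
    where open ≡-Reasoning

  /-row : ∀ c {g} → g < D → (c * D + g) / D ≡ c
  /-row c {g} g<D = begin
    (c * D + g) / D   ≡⟨ +-distrib-/ (c * D) g no-carry ⟩
    c * D / D + g / D ≡⟨ cong₂ _+_ (m*n/n≡m c D) (m<n⇒m/n≡0 g<D) ⟩
    c + 0             ≡⟨ +-identityʳ c ⟩
    c                 ∎
    where
    open ≡-Reasoning
    no-carry : (c * D) % D + g % D < D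
    no-carry = subst₂ (λ u v → u + v < D) (sym (m*n%n≡0 c D)) (sym (m<n⇒m%n≡m g<D)) g<D

  π-row : ∀ c {g} → g < D → π (c * D + g) ≡ offset g + c
  π-row c g<D = cong₂ _+_ (cong offset (%-row c g<D)) (/-row c g<D)

  ∑-π : ∀ (H : ℕ → ℕ) → ∑< N (H ∘ π) ≡ ∑< N H
  ∑-π H = begin
    ∑< N (H ∘ π)
      ≡⟨ ∑-rows (H ∘ π) ⟩
    ∑[ g < D ] ∑[ c < len g ] H (π (c * D + g))
      ≡⟨ ∑-cong D (λ {g} g<D → ∑-cong (len g) (λ {c} _ → cong H (π-row c g<D))) ⟩
    ∑[ g < D ] ∑[ c < len g ] H (offset g + c)
      ≡⟨ ∑-columns D H ⟨
    ∑< (offset D) H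
      ≡⟨ cong (λ k → ∑< k H) offset-D ⟩
    ∑< N H ∎
    where open ≡-Reasoning

  row-decomposition : ∀ y → y / D * D + y % D ≡ y
  row-decomposition y = trans (+-comm (y / D * D) (y % D)) (sym (m≡m%n+[m/n]*n y D))

  offset-< : ∀ {g c} → g < D → c < len g → offset g + c < N
  offset-< {g} {c} g<D c<len = begin-strict
    offset g + c     <⟨ +-monoʳ-< (offset g) c<len ⟩
    offset (suc g)   ≤⟨ ∑-monoˡ-≤ len g<D ⟩
    offset D         ≡⟨ offset-D ⟩
    N               ∎
    where open ≤-Reasoning

  row-< : ∀ c {g} → g < D → c * D + g < N → c < len g
  row-< c {g} g<D y<N with g <? r
  ... | yes g<r = subst (c <_) (sym (cong (C +_) (𝟙-T (<⇒<ᵇ g<r)))) (*-cancelʳ-< D c (C + 1) (begin-strict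
    c * D           ≤⟨ m≤m+n (c * D) g ⟩
    c * D + g       <⟨ y<N ⟩
    N               ≡⟨ C*D+r≡N ⟨
    C * D + r       <⟨ +-monoʳ-< (C * D) (m%n<n N D) ⟩
    C * D + D       ≡⟨ next-row C D ⟩
    (C + 1) * D     ∎))
    where
    open ≤-Reasoning
    next-row : ∀ c d → c * d + d ≡ (c + 1) * d
    next-row = solve-∀
  ... | no  g≮r = subst (c <_) (sym (trans (cong (C +_) (𝟙-¬T (g≮r ∘ <ᵇ⇒< g r))) (+-identityʳ C)))
    (*-cancelʳ-< D c C (+-cancelʳ-< r (c * D) (C * D) (begin-strict
      c * D + r     ≤⟨ +-monoʳ-≤ (c * D) (≮⇒≥ g≮r) ⟩
      c * D + g     <⟨ y<N ⟩
      N             ≡⟨ C*D+r≡N ⟨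
      C * D + r     ∎)))
    where open ≤-Reasoning

  π-< : ∀ {y} → y < N → π y < N
  π-< {y} y<N = offset-< (m%n<n y D) (row-< (y / D) (m%n<n y D) (subst (_< N) (sym (row-decomposition y)) y<N))

  -- As E * D + E ≤ C * D + r with r ≤ E, either D ≤ C, or C = r = E.
  long-column : E + E * D ≤ N → ∀ {h} → h < E → offset h + D ≤ offset (suc h)
  long-column wide {h} h<E = +-monoʳ-≤ (offset h) (D≤len (D ≤? C))
    where
    D≤len : Dec (D ≤ C) → D ≤ len h
    D≤len (yes D≤C) = ≤-trans D≤C (m≤m+n C _)
    D≤len (no  D≰C) = subst (D ≤_) (sym len≡D) ≤-refl
      where
      C≤E : C ≤ E
      C≤E = ≤-pred (≰⇒> D≰C)
      E*D≤C*D : E * D ≤ C * D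
      E*D≤C*D = +-cancelˡ-≤ E (E * D) (C * D) (begin
        E + E * D   ≤⟨ wide ⟩
        N           ≡⟨ C*D+r≡N ⟨
        C * D + r   ≤⟨ +-monoʳ-≤ (C * D) (≤-pred (m%n<n N D)) ⟩
        C * D + E   ≡⟨ +-comm (C * D) E ⟩
        E + C * D   ∎)
        where open ≤-Reasoning
      C≡E : C ≡ E
      C≡E = ≤-antisym C≤E (*-cancelʳ-≤ E C D E*D≤C*D)
      E≤r : E ≤ r
      E≤r = +-cancelˡ-≤ (E * D) E r (begin
        E * D + E   ≡⟨ +-comm (E * D) E ⟩
        E + E * D   ≤⟨ wide ⟩
        N           ≡⟨ C*D+r≡N ⟨
        C * D + r   ≡⟨ cong (λ k → k * D + r) C≡E ⟩
        E * D + r   ∎)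
        where open ≤-Reasoning
      len≡D : len h ≡ D
      len≡D = begin
        C + 𝟙 (h <ᵇ r)  ≡⟨ cong₂ _+_ C≡E (𝟙-T (<⇒<ᵇ (≤-trans h<E E≤r))) ⟩
        E + 1           ≡⟨ +-comm E 1 ⟩
        D               ∎
        where open ≡-Reasoning

  module _ {α β : ℕ → ℕ} (wide : E + E * D ≤ N) (α-short : ShortFibres D N α)
           (β-short : ShortFibres D N β) (β-aligned : FullFibresAligned E N β) where

    same-row : ∀ {g g' c} → g < g' → g' < D → offset g' + c < N → α (offset g + c) ≢ α (offset g' + c)
    same-row {g} {g'} {c} g<g' g'<D = short-far α-short (begin
      offset g + c + D    ≡⟨ rotate (offset g) c D ⟩
      offset g + D + c    ≤⟨ +-monoˡ-≤ c (long-column wide (≤-trans g<g' (≤-pred g'<D))) ⟩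
      offset (suc g) + c  ≤⟨ +-monoˡ-≤ c (∑-monoˡ-≤ len g<g') ⟩
      offset g' + c       ∎)
      where
      open ≤-Reasoning
      rotate : ∀ a c d → a + c + d ≡ a + d + c
      rotate = solve-∀

    -- β forces the later cell into the next row and at least one column to the left.  Exactly
    -- one column to the left puts the two B-positions E apart, which alignment rules out; any
    -- further left puts the A-positions two long columns apart.
    later-row : ∀ {g c g' c'} → g < D → offset g + c < N → c < c' → c' * D + g' < N →
                α (offset g + c) ≡ α (offset g' + c') → β (c * D + g) ≡ β (c' * D + g') → ⊥
    later-row {g} {c} {g'} {c'} g<D x<N c<c' y'<N αeq βeq
      with adjacent-row g<D c<c' (β-short (row-order g<D c<c') y'<N βeq)
    ... | refl , g'<g with m≤n⇒m<n∨m≡n g'<g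
    ...   | inj₂ refl = 0≢1+n (trans (sym aligned) (%-row c g<D))
      where
      shift : ∀ c g' E → c * suc E + suc g' + E ≡ suc c * suc E + g'
      shift = solve-∀
      aligned : (c * D + suc g') % D ≡ 0
      aligned = β-aligned (subst (_< N) (sym (shift c g' E)) y'<N) (trans βeq (cong β (sym (shift c g' E))))
    ...   | inj₁ 1+g'<g = short-far α-short gap x<N (sym αeq)
      where
      1+g'<E : suc g' < E
      1+g'<E = ≤-trans 1+g'<g (≤-pred g<D)
      gap : offset g' + suc c + D ≤ offset g + c
      gap = begin
        offset g' + suc c + D        ≤⟨ +-monoˡ-≤ D (+-monoʳ-≤ (offset g') (+-monoˡ-≤ c (s≤s z≤n))) ⟩
        offset g' + (D + c) + D      ≡⟨ rearrange (offset g') D c ⟩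
        offset g' + D + D + c        ≤⟨ +-monoˡ-≤ c (+-monoˡ-≤ D (long-column wide (<-trans (n<1+n g') 1+g'<E))) ⟩
        offset (suc g') + D + c      ≤⟨ +-monoˡ-≤ c (long-column wide 1+g'<E) ⟩
        offset (suc (suc g')) + c    ≤⟨ +-monoˡ-≤ c (∑-monoˡ-≤ len 1+g'<g) ⟩
        offset g + c                 ∎
        where
        open ≤-Reasoning
        rearrange : ∀ a d c → a + (d + c) + d ≡ a + d + d + c
        rearrange = solve-∀

    cell-injective : ∀ {g c g' c'} → g < D → g' < D → offset g + c < N → offset g' + c' < N →
                     c * D + g < N → c' * D + g' < N →
                     α (offset g + c) ≡ α (offset g' + c') → β (c * D + g) ≡ β (c' * D + g') →
                     c * D + g ≡ c' * D + g'
    cell-injective {g} {c} {g'} {c'} g<D g'<D x<N x'<N y<N y'<N αeq βeq with <-cmp c c'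
    ... | tri< c<c' _ _ = ⊥-elim (later-row g<D x<N c<c' y'<N αeq βeq)
    ... | tri> _ _ c'<c = ⊥-elim (later-row g'<D x'<N c'<c y<N (sym αeq) (sym βeq))
    ... | tri≈ _ refl _ with <-cmp g g'
    ...   | tri< g<g' _ _ = ⊥-elim (same-row g<g' g'<D x'<N αeq)
    ...   | tri> _ _ g'<g = ⊥-elim (same-row g'<g g<D x<N (sym αeq))
    ...   | tri≈ _ refl _ = refl

    π-injective : JointlyInjective N (α ∘ π) β
    π-injective {y} {y'} y<N y'<N αeq βeq = begin
      y                    ≡⟨ row-decomposition y ⟨
      y / D * D + y % D    ≡⟨ cell-injective (m%n<n y D) (m%n<n y' D) (π-< y<N) (π-< y'<N)
                                (as-row y<N) (as-row y'<N) αeq (as-row-β βeq) ⟩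
      y' / D * D + y' % D  ≡⟨ row-decomposition y' ⟩
      y'                   ∎
      where
      open ≡-Reasoning
      as-row : ∀ {z} → z < N → z / D * D + z % D < N
      as-row {z} = subst (_< N) (sym (row-decomposition z))
      as-row-β : β y ≡ β y' → β (y / D * D + y % D) ≡ β (y' / D * D + y' % D)
      as-row-β = subst₂ (λ u v → β u ≡ β v) (sym (row-decomposition y)) (sym (row-decomposition y'))

  blocks-injective : ∀ {a b} → E + E * D ≤ N → sum a ≡ N → sum b ≡ N →
                     All (_≤ D) a → All (_≤ D) b → AllPairs _≥_ b →
                     JointlyInjective N (block a ∘ π) (block b)
  blocks-injective {a} {b} wide Σa≡N Σb≡N a≤D b≤D b-sorted = π-injective wide
    (subst (λ n → ShortFibres D n (block a)) Σa≡N (block-short a a≤D))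
    (subst (λ n → ShortFibres D n (block b)) Σb≡N (block-short b b≤D))
    (subst (λ n → FullFibresAligned E n (block b)) Σb≡N (block-aligned b b-sorted b≤D))

-- Matrices with prescribed margins and bipartite multigraphs

fill-step : ∀ n S v → n ⊓ S + v ⊓ (n ∸ S) ≡ n ⊓ (S + v)
fill-step n S v with ≤-total n S
... | inj₁ n≤S = begin
  n ⊓ S + v ⊓ (n ∸ S)   ≡⟨ cong₂ (λ a b → a + v ⊓ b) (m≤n⇒m⊓n≡m n≤S) (m≤n⇒m∸n≡0 n≤S) ⟩
  n + v ⊓ 0             ≡⟨ cong (n +_) (⊓-zeroʳ v) ⟩
  n + 0                 ≡⟨ +-identityʳ n ⟩
  n                     ≡⟨ m≤n⇒m⊓n≡m (≤-trans n≤S (m≤m+n S v)) ⟨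
  n ⊓ (S + v)           ∎
  where open ≡-Reasoning
... | inj₂ S≤n = begin
  n ⊓ S + v ⊓ (n ∸ S)         ≡⟨ cong (_+ v ⊓ (n ∸ S)) (m≥n⇒m⊓n≡n S≤n) ⟩
  S + v ⊓ (n ∸ S)             ≡⟨ +-distribˡ-⊓ S v (n ∸ S) ⟩
  (S + v) ⊓ (S + (n ∸ S))     ≡⟨ cong ((S + v) ⊓_) (m+[n∸m]≡n S≤n) ⟩
  (S + v) ⊓ n                 ≡⟨ ⊓-comm (S + v) n ⟩
  n ⊓ (S + v)                 ∎
  where open ≡-Reasoning

fill : ℕ → (ℕ → ℕ) → ℕ → ℕ
fill n v j = v j ⊓ (n ∸ ∑< j v)

∑-fill : ∀ n v q → ∑< q (fill n v) ≡ n ⊓ ∑< q v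
∑-fill n v zero    = sym (⊓-zeroʳ n)
∑-fill n v (suc q) = trans (cong (_+ fill n v q) (∑-fill n v q)) (fill-step n (∑< q v) (v q))

record Margins (p q : ℕ) (u v : ℕ → ℕ) : Set where
  field
    matrix : ℕ → ℕ → ℕ
    rows   : ∀ {i} → i < p → ∑< q (matrix i) ≡ u i
    cols   : ∀ {j} → j < q → ∑[ i < p ] matrix i j ≡ v j

matrix-with-margins : ∀ p q (u v : ℕ → ℕ) → ∑< p u ≡ ∑< q v → Margins p q u v
matrix-with-margins zero    q u v ∑u≡∑v = record
  { matrix = λ _ _ → 0 ; rows = λ () ; cols = λ j<q → sym (∑≡0⇒≡0 q v (sym ∑u≡∑v) j<q) }
matrix-with-margins (suc p) q u v ∑u≡∑v = record { matrix = R ; rows = rows ; cols = cols }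
  where
  w : ℕ → ℕ
  w = fill (u 0) v
  w≤v : ∀ j → w j ≤ v j
  w≤v j = m⊓n≤m (v j) _
  ∑w : ∑< q w ≡ u 0
  ∑w = trans (∑-fill (u 0) v q)
             (m≤n⇒m⊓n≡m (subst (u 0 ≤_) (trans (sym (∑-split 1 p u)) ∑u≡∑v) (m≤m+n (u 0) _)))
  ∑rest : u 0 + ∑[ i < p ] u (suc i) ≡ u 0 + ∑[ j < q ] (v j ∸ w j)
  ∑rest = begin
    u 0 + ∑[ i < p ] u (suc i)        ≡⟨ trans (sym (∑-split 1 p u)) ∑u≡∑v ⟩
    ∑< q v                            ≡⟨ ∑-cong q (λ {j} _ → m+[n∸m]≡n (w≤v j)) ⟨
    ∑[ j < q ] (w j + (v j ∸ w j))    ≡⟨ ∑-distrib-+ q w _ ⟩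
    ∑< q w + ∑[ j < q ] (v j ∸ w j)   ≡⟨ cong (_+ ∑[ j < q ] (v j ∸ w j)) ∑w ⟩
    u 0 + ∑[ j < q ] (v j ∸ w j)      ∎
    where open ≡-Reasoning
  module Rest = Margins (matrix-with-margins p q (u ∘ suc) (λ j → v j ∸ w j) (+-cancelˡ-≡ (u 0) _ _ ∑rest))
  R : ℕ → ℕ → ℕ
  R zero    j = w j
  R (suc i) j = Rest.matrix i j
  rows : ∀ {i} → i < suc p → ∑< q (R i) ≡ u i
  rows {zero}  _         = ∑w
  rows {suc i} (s≤s i<p) = Rest.rows i<p
  cols : ∀ {j} → j < q → ∑[ i < suc p ] R i j ≡ v j
  cols {j} j<q = trans (∑-split 1 p (λ i → R i j)) (trans (cong (w j +_) (Rest.cols j<q)) (m+[n∸m]≡n (w≤v j)))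

sum-tabulate : ∀ n (f : ℕ → ℕ) → sum (tabulate {n = n} (f ∘ toℕ)) ≡ ∑< n f
sum-tabulate zero    f = refl
sum-tabulate (suc n) f = trans (cong (f 0 +_) (sum-tabulate n (f ∘ suc))) (sym (∑-split 1 n f))

toMultigraph : ∀ {p q} → (ℕ → ℕ → ℕ) → BipMultigraph p q
toMultigraph M i j = M (toℕ i) (toℕ j)

module _ {p q : ℕ} (M : ℕ → ℕ → ℕ) where

  degA-toMultigraph : ∀ i → degA (toMultigraph {p} {q} M) i ≡ ∑< q (M (toℕ i))
  degA-toMultigraph i = sum-tabulate q (M (toℕ i))

  degB-toMultigraph : ∀ j → degB (toMultigraph {p} {q} M) j ≡ ∑[ i < p ] M i (toℕ j)
  degB-toMultigraph j = sum-tabulate p (λ i → M i (toℕ j))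

  ∑∑-toMultigraph : (f : ℕ → ℕ) →
    sum (tabulate (λ i → sum (tabulate (λ j → f (toMultigraph {p} {q} M i j))))) ≡ ∑[ i < p ] ∑[ j < q ] f (M i j)
  ∑∑-toMultigraph f = trans (cong sum (tabulate-cong {n = p} (λ i → sum-tabulate q (λ j → f (M (toℕ i) j)))))
                             (sum-tabulate p (λ i → ∑[ j < q ] f (M i j)))

TotMult-toMultigraph-≤ : ∀ {p q} (M R : ℕ → ℕ → ℕ) → (∀ i j → M i j ≤ 1) →
                         TotMult (toMultigraph {p} {q} (λ i j → M i j + R i j)) ≤ ∑[ i < p ] ∑< q (R i)
TotMult-toMultigraph-≤ {p} {q} M R simple = m≤n+o⇒m∸n≤o _ _ (begin
  numEdges G
    ≡⟨ ∑∑-toMultigraph {p} {q} M+R (λ e → e) ⟩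
  ∑[ i < p ] ∑[ j < q ] (M i j + R i j)
    ≤⟨ ∑-mono-≤ p (λ _ → ∑-mono-≤ q (λ _ → bound _ _)) ⟩
  ∑[ i < p ] ∑[ j < q ] (indicator (M i j + R i j) + R i j)
    ≡⟨ ∑-cong p (λ {i} _ → ∑-distrib-+ q _ (R i)) ⟩
  ∑[ i < p ] (∑[ j < q ] indicator (M i j + R i j) + ∑< q (R i))
    ≡⟨ ∑-distrib-+ p _ _ ⟩
  ∑[ i < p ] ∑[ j < q ] indicator (M i j + R i j) + ∑[ i < p ] ∑< q (R i)
    ≡⟨ cong (_+ ∑[ i < p ] ∑< q (R i)) (∑∑-toMultigraph {p} {q} M+R indicator) ⟨
  numSimpleEdges G + ∑[ i < p ] ∑< q (R i) ∎)
  where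
  open ≤-Reasoning
  M+R : ℕ → ℕ → ℕ
  M+R i j = M i j + R i j
  G : BipMultigraph p q
  G = toMultigraph M+R
  bound : ∀ i j → M i j + R i j ≤ indicator (M i j + R i j) + R i j
  bound i j with M i j | simple i j
  ... | 0 | _       = m≤n+m (R i j) (indicator (R i j))
  ... | 1 | _       = ≤-refl
  ... | suc (suc _) | s≤s ()

-- Each cell y < N carries an A-label A y and a B-label B y, labels beyond length a resp.
-- length b standing for padding vertices.  The cells with two genuine labels form a simple
-- graph; the degree it misses is the same on both sides and is filled in by a matrix with
-- these margins.
module _ (a b : List ℕ) (N : ℕ) (A B : ℕ → ℕ) where

  private
    p q : ℕ
    p = length a
    q = length b

    P Q : ℕ → Bool
    P y = A y <ᵇ p
    Q y = B y <ᵇ q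

    edges : ℕ → ℕ → ℕ
    edges i j = count N (λ y → (A y ≡ᵇ i) ∧ (B y ≡ᵇ j))

    missingA : ℕ → ℕ
    missingA i = count N (λ y → (A y ≡ᵇ i) ∧ not (Q y))

    missingB : ℕ → ℕ
    missingB j = count N (λ y → not (P y) ∧ (B y ≡ᵇ j))

    edges-≤1 : JointlyInjective N A B → ∀ i j → edges i j ≤ 1
    edges-≤1 injective i j = count-≤1 N _ λ y<N y'<N t t' →
      let A≡ , B≡ = Equivalence.to T-∧ t ; A'≡ , B'≡ = Equivalence.to T-∧ t'
      in injective y<N y'<N (trans (≡ᵇ⇒≡ _ _ A≡) (sym (≡ᵇ⇒≡ _ _ A'≡)))
                            (trans (≡ᵇ⇒≡ _ _ B≡) (sym (≡ᵇ⇒≡ _ _ B'≡)))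

    ∑-missingA : ∑< p missingA ≡ count N (λ y → P y ∧ not (Q y))
    ∑-missingA = ∑-count-≡ᵇ-∧ p N A (not ∘ Q)

    ∑-missing : count N P ≡ count N Q → ∑< p missingA ≡ ∑< q missingB
    ∑-missing balanced = begin
      ∑< p missingA                       ≡⟨ ∑-missingA ⟩
      count N (λ y → P y ∧ not (Q y))     ≡⟨ +-cancelˡ-≡ (count N (λ y → P y ∧ Q y)) _ _
                                               (trans (count-∧-not N P Q) (trans balanced (sym (count-not-∧ N P Q)))) ⟩
      count N (λ y → not (P y) ∧ Q y)     ≡⟨ ∑-count-∧-≡ᵇ q N (not ∘ P) B ⟨
      ∑< q missingB                       ∎
      where open ≡-Reasoning

  cells-bigraphic : ∀ {t} →
    JointlyInjective N A B →
    (∀ i → count N (λ y → A y ≡ᵇ toℕ i) ≡ lookup a i) →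
    (∀ j → count N (λ y → B y ≡ᵇ toℕ j) ≡ lookup b j) →
    count N P ≡ count N Q →
    count N (not ∘ Q) ≤ t →
    TotBigraphic t (a , b)
  cells-bigraphic {t} injective countA countB balanced few = G , degA-G , degB-G , TotMult-G
    where
    open Margins (matrix-with-margins p q missingA missingB (∑-missing balanced)) renaming (matrix to R)
    M : ℕ → ℕ → ℕ
    M i j = edges i j + R i j
    G : BipMultigraph p q
    G = toMultigraph M
    degA-G : ∀ i → degA G i ≡ lookup a i
    degA-G i = begin
      degA G i
        ≡⟨ degA-toMultigraph {p} {q} M i ⟩
      ∑[ j < q ] (edges (toℕ i) j + R (toℕ i) j)
        ≡⟨ ∑-distrib-+ q _ _ ⟩
      ∑< q (edges (toℕ i)) + ∑< q (R (toℕ i))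
        ≡⟨ cong₂ _+_ (∑-count-∧-≡ᵇ q N (λ y → A y ≡ᵇ toℕ i) B) (rows (toℕ<n i)) ⟩
      count N (λ y → (A y ≡ᵇ toℕ i) ∧ Q y) + missingA (toℕ i)
        ≡⟨ count-∧-not N (λ y → A y ≡ᵇ toℕ i) Q ⟩
      count N (λ y → A y ≡ᵇ toℕ i)
        ≡⟨ countA i ⟩
      lookup a i ∎
      where open ≡-Reasoning
    degB-G : ∀ j → degB G j ≡ lookup b j
    degB-G j = begin
      degB G j
        ≡⟨ degB-toMultigraph {p} {q} M j ⟩
      ∑[ i < p ] (edges i (toℕ j) + R i (toℕ j))
        ≡⟨ ∑-distrib-+ p _ _ ⟩
      ∑[ i < p ] edges i (toℕ j) + ∑[ i < p ] R i (toℕ j)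
        ≡⟨ cong₂ _+_ (∑-count-≡ᵇ-∧ p N A (λ y → B y ≡ᵇ toℕ j)) (cols (toℕ<n j)) ⟩
      count N (λ y → P y ∧ (B y ≡ᵇ toℕ j)) + missingB (toℕ j)
        ≡⟨ count-not-∧ N P (λ y → B y ≡ᵇ toℕ j) ⟩
      count N (λ y → B y ≡ᵇ toℕ j)
        ≡⟨ countB j ⟩
      lookup b j ∎
      where open ≡-Reasoning
    TotMult-G : TotMult G ≤ t
    TotMult-G = begin
      TotMult G                          ≤⟨ TotMult-toMultigraph-≤ {p} {q} edges R (edges-≤1 injective) ⟩
      ∑[ i < p ] ∑< q (R i)              ≡⟨ ∑-cong p rows ⟩
      ∑< p missingA                      ≡⟨ ∑-missingA ⟩
      count N (λ y → P y ∧ not (Q y))    ≤⟨ count-∧-≤ʳ N P (not ∘ Q) ⟩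
      count N (λ y → not (Q y))          ≤⟨ few ⟩
      t                                  ∎
      where open ≤-Reasoning

-- Padding and the theorem

interleaving-⊆ʳ : ∀ {l r d : List ℕ} → Interleaving l r d → r ⊆ d
interleaving-⊆ʳ []          = []
interleaving-⊆ʳ (consˡ sp) = _ ∷ʳ interleaving-⊆ʳ sp
interleaving-⊆ʳ (consʳ sp) = refl ∷ interleaving-⊆ʳ sp

AllPairs-resp-⊆ : ∀ {R : ℕ → ℕ → Set} {xs ys} → xs ⊆ ys → AllPairs R ys → AllPairs R xs
AllPairs-resp-⊆ []         []       = []
AllPairs-resp-⊆ (_ ∷ʳ τ)   (_ ∷ ps) = AllPairs-resp-⊆ τ ps
AllPairs-resp-⊆ (refl ∷ τ) (p ∷ ps) = All-resp-⊆ τ p ∷ AllPairs-resp-⊆ τ ps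

AllPairs-replicate : ∀ {R : ℕ → ℕ → Set} {x} → R x x → ∀ k → AllPairs R (replicate k x)
AllPairs-replicate Rxx zero    = []
AllPairs-replicate Rxx (suc k) = All.replicate⁺ k Rxx ∷ AllPairs-replicate Rxx k

sum-replicate-1 : ∀ k → sum (replicate k 1) ≡ k
sum-replicate-1 zero    = refl
sum-replicate-1 (suc k) = cong suc (sum-replicate-1 k)

sorted-padding : ∀ {b} k → AllPairs _≥_ b → All (0 <_) b → AllPairs _≥_ (b ++ replicate k 1)
sorted-padding k b-sorted b-positive =
  AllPairs.++⁺ b-sorted (AllPairs-replicate ≤-refl k) (All.map (All.replicate⁺ k) b-positive)

padded-bigraphic : ∀ {t} E k (a b : List ℕ) → sum a ≡ sum b →
                   All (_≤ suc E) a → All (_≤ suc E) b → AllPairs _≥_ b → All (0 <_) b →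
                   E + E * suc E ≤ sum a + k → k ≤ t → TotBigraphic t (a , b)
padded-bigraphic {t} E k a b Σa≡Σb a≤D b≤D b-sorted b-positive wide k≤t =
  cells-bigraphic a b N (block a' ∘ π) (block b') injective countA countB balanced few
  where
  ones a' b' : List ℕ
  ones = replicate k 1
  a'   = a ++ ones
  b'   = b ++ ones
  N : ℕ
  N = sum a + sum ones
  open Grid E N
  Σb'≡N : sum b + sum ones ≡ N
  Σb'≡N = cong (_+ sum ones) (sym Σa≡Σb)
  injective : JointlyInjective N (block a' ∘ π) (block b')
  injective = blocks-injective (subst (λ n → E + E * D ≤ sum a + n) (sym (sum-replicate-1 k)) wide)
    (sum-++ a ones) (trans (sum-++ b ones) Σb'≡N) (All.++⁺ a≤D (All.replicate⁺ k (s≤s z≤n)))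
    (All.++⁺ b≤D (All.replicate⁺ k (s≤s z≤n))) (sorted-padding k b-sorted b-positive)
  countA : ∀ i → count N (λ y → block a' (π y) ≡ᵇ toℕ i) ≡ lookup a i
  countA i = trans (∑-π (λ x → 𝟙 (block a' x ≡ᵇ toℕ i))) (count-block-++-≡ᵇ a ones i)
  countB : ∀ j → count N (λ y → block b' y ≡ᵇ toℕ j) ≡ lookup b j
  countB j = subst (λ n → count n (λ y → block b' y ≡ᵇ toℕ j) ≡ lookup b j) Σb'≡N
                   (count-block-++-≡ᵇ b ones j)
  Q : ℕ → Bool
  Q y = block b' y <ᵇ length b
  countQ : count N Q ≡ sum a
  countQ = subst (λ n → count n Q ≡ sum a) Σb'≡N (trans (count-block-++-<ᵇ b ones) (sym Σa≡Σb))
  balanced : count N (λ y → block a' (π y) <ᵇ length a) ≡ count N Q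
  balanced = trans (∑-π (λ x → 𝟙 (block a' x <ᵇ length a))) (trans (count-block-++-<ᵇ a ones) (sym countQ))
  few : count N (not ∘ Q) ≤ t
  few = begin
    count N (not ∘ Q)    ≡⟨ +-cancelˡ-≡ (sum a) _ _ (trans (cong (_+ count N (not ∘ Q)) (sym countQ))
                                                          (count-not N Q)) ⟩
    sum ones             ≡⟨ sum-replicate-1 k ⟩
    k                    ≤⟨ k≤t ⟩
    t                    ∎
    where open ≤-Reasoning

head-bounds : ∀ {x xs} → AllPairs _≥_ (x ∷ xs) → All (_≤ x) (x ∷ xs)
head-bounds (xs≤x ∷ _) = ≤-refl ∷ xs≤x

half-sum : ∀ {a b d} → Interleaving a b d → sum a ≡ sum b → sum d / 2 ≡ sum a
half-sum {a} {b} {d} a⋎b Σa≡Σb = begin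
  sum d / 2              ≡⟨ cong (_/ 2) (sum-↭ (toPermutation a⋎b)) ⟩
  sum (a ++ b) / 2       ≡⟨ cong (_/ 2) (trans (sum-++ a b) (cong (sum a +_) (sym Σa≡Σb))) ⟩
  (sum a + sum a) / 2    ≡⟨ cong (_/ 2) (trans (cong (sum a +_) (sym (+-identityʳ (sum a)))) (*-comm 2 (sum a))) ⟩
  sum a * 2 / 2          ≡⟨ m*n/n≡m (sum a) 2 ⟩
  sum a                  ∎
  where open ≡-Reasoning

corollary41 : (t : ℕ) → 1 ≤ t → (d₁ : ℕ) → (ds : List ℕ) →
    IsDegreeSequence (d₁ ∷ ds) →
    ∃ (λ ab → InBP (d₁ ∷ ds) ab) →
    d₁ * d₁ ≤ sum (d₁ ∷ ds) / 2 + t + 1 →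
    (ab : List ℕ × List ℕ) → InBP (d₁ ∷ ds) ab → TotBigraphic t ab
corollary41 t _ zero    ds (_ , () ∷ _ , _) _ _ _ _
corollary41 t _ (suc E) ds (linked , positive , _) _ d₁²≤ (a , b) (a⋎b , Σa≡Σb) =
  padded-bigraphic E (E + E * suc E ∸ sum a) a b Σa≡Σb
    (All-resp-⊆ a⊆d (head-bounds sorted)) (All-resp-⊆ b⊆d (head-bounds sorted))
    (AllPairs-resp-⊆ b⊆d sorted) (All-resp-⊆ b⊆d positive)
    (m≤n+m∸n (E + E * suc E) (sum a)) (m≤n+o⇒m∸n≤o (E + E * suc E) (sum a) d₁²-1≤σ+t)
  where
  sorted : AllPairs _≥_ (suc E ∷ ds)
  sorted = Linked⇒AllPairs (λ x≥y y≥z → ≤-trans y≥z x≥y) linked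
  a⊆d : a ⊆ suc E ∷ ds
  a⊆d = interleaving-⊆ʳ (swap a⋎b)
  b⊆d : b ⊆ suc E ∷ ds
  b⊆d = interleaving-⊆ʳ a⋎b
  -- suc E * suc E reduces to suc (E + E * suc E), so the hypothesis reads d₁² − 1 ≤ σ + t.
  d₁²-1≤σ+t : E + E * suc E ≤ sum a + t
  d₁²-1≤σ+t = ≤-pred (subst (suc E * suc E ≤_)
    (trans (cong (λ s → s + t + 1) (half-sum a⋎b Σa≡Σb)) (+-comm (sum a + t) 1)) d₁²≤)
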